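{- Let $p$ be a prime and let $\mathcal{C}_1\subset\mathcal{C}_2\subset\mathcal{C}_1^\perp$ be codes of length $n$ over $\mathbf{Z}_p$ with generator matrices $\begin{bmatrix} I_{k_1}&A\end{bmatrix}$ and $\begin{bmatrix} I_{k_1}&A\\0&B\end{bmatrix}$, where $A\in M_{k_1\times(n-k_1)}(\mathbf{Z})$, $B\in M_{k_2\times(n-k_1)}(\mathbf{Z})$, $\dim\mathcal{C}_1=k_1$, $\dim\mathcal{C}_2=k_1+k_2$; if $p=2$, assume $\mathcal{C}_1$ is doubly even. Let $X$ be the set of self-orthogonal codes $\mathcal{C}$ over $\mathbf{Z}_{p^2}$ of length $n$ with $\pi(\mathcal{C})=\iota^{ -1}(\mathcal{C})=\mathcal{C}_1$, and $X'$ the set of self-orthogonal codes $\mathcal{C}'$ over $\mathbf{Z}_{p^2}$ of length $n$ with $\pi(\mathcal{C}')=\mathcal{C}_1$ and $\iota^{ -1}(\mathcal{C}')=\mathcal{C}_2$. Then for every $\mathcal{C}'\in X'$, $|\{\mathcal{C}\in X:\mathcal{C}\subset\mathcal{C}'\}|=p^{k_1k_2}$.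
   Context: A code of length $n$ over $\mathbf{Z}_m$ is a $\mathbf{Z}_m$-submodule of $\mathbf{Z}_m^n$; an integer matrix $G\in M_{k\times n}(\mathbf{Z})$ is a generator matrix of $\mathcal{C}$ if $\mathcal{C}=\{aG\bmod m:a\in\mathbf{Z}^k\}$. Duals and self-orthogonality ($\mathcal{C}\subset\mathcal{C}^\perp$) refer to the standard inner product. $\pi:\mathbf{Z}_{p^2}^n\to\mathbf{Z}_p^n$ is reduction mod $p$ and $\iota:\mathbf{Z}_p^n\to\mathbf{Z}_{p^2}^n$ is $x\bmod p\mapsto px\bmod p^2$. A binary code is doubly even if all Hamming weights are divisible by $4$. -}

module Defs where

open import Data.Nat as ℕ using (ℕ; zero; suc; _^_; NonZero; _≡ᵇ_)
open import Data.Nat.Properties using (m*n≢0)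
open import Data.Integer as ℤ using (ℤ; +_; _%ℕ_)
open import Data.Integer.DivMod using (n%ℕd<d)
open import Data.Integer.Divisibility using (_∣_)
open import Data.Fin using (Fin; toℕ; fromℕ<; combine; splitAt; _≟_)
open import Data.Fin.Subset using (Subset) renaming (_∈_ to _∈ₛ_)
open import Data.Vec using (Vec; []; _∷_; map; zipWith; tabulate; replicate; lookup)
open import Data.Sum using (inj₁; inj₂)
open import Data.Product using (Σ; _×_; ∃; ∃-syntax)
open import Data.Bool using (if_then_else_)
open import Relation.Nullary.Decidable using (⌊_⌋)
open import Relation.Binary.PropositionalEquality using (_≡_)
open import Function.Bundles using (_⇔_)

instance
  sqNonZero : ∀ {p} .{{_ : NonZero p}} → NonZero (p ℕ.* p)
  sqNonZero {p} = m*n≢0 p p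

[_]_ : (m : ℕ) .{{_ : NonZero m}} → ℤ → Fin m
[ m ] x = fromℕ< (n%ℕd<d x m)

⟦_⟧ : ∀ {m} → Fin m → ℤ
⟦ a ⟧ = + toℕ a

Word : ℕ → ℕ → Set
Word m n = Vec (Fin m) n

Mat : ℕ → ℕ → Set
Mat k n = Fin k → Fin n → ℤ

∑ : ∀ {k} → (Fin k → ℤ) → ℤ
∑ {zero}  f = + 0
∑ {suc k} f = f Fin.zero ℤ.+ ∑ (λ i → f (Fin.suc i))
  where import Data.Fin as Fin

aG : ∀ {k n} (m : ℕ) .{{_ : NonZero m}} → Mat k n → (Fin k → ℤ) → Word m n
aG m G a = tabulate (λ j → [ m ] ∑ (λ i → a i ℤ.* G i j))

I : ∀ k → Mat k k
I k i j = if ⌊ i ≟ j ⌋ then + 1 else + 0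

O : ∀ k n → Mat k n
O k n i j = + 0

hcat : ∀ {k a b} → Mat k a → Mat k b → Mat k (a ℕ.+ b)
hcat {a = a} P Q i j with splitAt a j
... | inj₁ j′ = P i j′
... | inj₂ j′ = Q i j′

vcat : ∀ {k l n} → Mat k n → Mat l n → Mat (k ℕ.+ l) n
vcat {k = k} P Q i j with splitAt k i
... | inj₁ i′ = P i′ j
... | inj₂ i′ = Q i′ j

-- Codes: subsets of Z_m^n, stored as characteristic vectors indexed by
-- Fin (m ^ n), via the bijection encode : Z_m^n → Fin (m ^ n).

encode : ∀ {m n} → Word m n → Fin (m ^ n)
encode []      = Fin.zero  where import Data.Fin as Fin
encode (a ∷ v) = combine a (encode v)

record Code (m n : ℕ) : Set where
  constructor mkCode
  field
    chars : Subset (m ^ n)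

infix 4 _∈C_
_∈C_ : ∀ {m n} → Word m n → Code m n → Set
x ∈C C = encode x ∈ₛ Code.chars C

_⊆C_ : ∀ {m n} → Code m n → Code m n → Set
C ⊆C D = ∀ x → x ∈C C → x ∈C D

record IsCode (m : ℕ) .{{_ : NonZero m}} {n} (C : Code m n) : Set where
  field
    has-zero : replicate n ([ m ] (+ 0)) ∈C C
    add-closed : ∀ x y → x ∈C C → y ∈C C →
                 zipWith (λ a b → [ m ] (⟦ a ⟧ ℤ.+ ⟦ b ⟧)) x y ∈C C
    scal-closed : ∀ (c : ℤ) x → x ∈C C → map (λ a → [ m ] (c ℤ.* ⟦ a ⟧)) x ∈C C

HasGenerator : ∀ {k n} (m : ℕ) .{{_ : NonZero m}} → Code m n → Mat k n → Set
HasGenerator {k} m C G = ∀ x → (x ∈C C) ⇔ (∃[ a ] (x ≡ aG m G a))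

-- standard inner product (as an integer; compare mod m)
dot : ∀ {m n} → Word m n → Word m n → ℤ
dot x y = ∑ (λ j → ⟦ lookup x j ⟧ ℤ.* ⟦ lookup y j ⟧)

_∈⊥_ : ∀ {m n} → Word m n → Code m n → Set
_∈⊥_ {m} x C = ∀ y → y ∈C C → (+ m) ∣ dot x y

_⊆⊥_ : ∀ {m n} → Code m n → Code m n → Set
C ⊆⊥ D = ∀ x → x ∈C C → x ∈⊥ D

SelfOrthogonal : ∀ {m n} → Code m n → Set
SelfOrthogonal C = C ⊆⊥ C

HasDim : ∀ {n} (p : ℕ) .{{_ : NonZero p}} → Code p n → ℕ → Set
HasDim {n} p C d =
  Σ (Fin d → Word p n) λ b →
    let Mb : Mat d n
        Mb i j = ⟦ lookup (b i) j ⟧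
    in (∀ i → b i ∈C C)
     × (∀ c → aG p Mb c ≡ replicate n ([ p ] (+ 0)) → ∀ i → (+ p) ∣ c i)
     × (∀ x → x ∈C C → ∃[ c ] (x ≡ aG p Mb c))

wt : ∀ {m n} → Word m n → ℕ
wt []      = 0
wt (a ∷ v) = (if toℕ a ≡ᵇ 0 then 0 else 1) ℕ.+ wt v

-- (used only for binary codes, i.e. m = 2)
DoublyEven : ∀ {m n} → Code m n → Set
DoublyEven C = ∀ x → x ∈C C → 4 Data.Nat.Divisibility.∣ wt x
  where import Data.Nat.Divisibility

π : ∀ {n} (p : ℕ) .{{_ : NonZero p}} → Word (p ℕ.* p) n → Word p n
π p = map (λ a → [ p ] ⟦ a ⟧)

ι : ∀ {n} (p : ℕ) .{{_ : NonZero p}} → Word p n → Word (p ℕ.* p) n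
ι p = map (λ a → [ p ℕ.* p ] ((+ p) ℤ.* ⟦ a ⟧))

ImageIs : ∀ {n} (p : ℕ) .{{_ : NonZero p}} → Code (p ℕ.* p) n → Code p n → Set
ImageIs p C D = ∀ v → (v ∈C D) ⇔ (∃[ c ] (c ∈C C × π p c ≡ v))

PreimageIs : ∀ {n} (p : ℕ) .{{_ : NonZero p}} → Code (p ℕ.* p) n → Code p n → Set
PreimageIs p C D = ∀ v → (v ∈C D) ⇔ (ι p v ∈C C)

InX : ∀ {n} (p : ℕ) .{{_ : NonZero p}} → Code p n → Code (p ℕ.* p) n → Set
InX p C1 C = IsCode (p ℕ.* p) C × SelfOrthogonal C × ImageIs p C C1 × PreimageIs p C C1

InX′ : ∀ {n} (p : ℕ) .{{_ : NonZero p}} → Code p n → Code p n → Code (p ℕ.* p) n → Set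
InX′ p C1 C2 C′ = IsCode (p ℕ.* p) C′ × SelfOrthogonal C′ × ImageIs p C′ C1 × PreimageIs p C′ C2

-- Fix a lift G₀ of the generator [I A] of C₁ into C′ whose leading k₁ × k₁ block is exactly I.
-- For every k₁ × k₂ matrix D over Z_p the systematic matrix G₀ + p·D·[0 B] spans a self-orthogonal
-- code inside C′ (the rows of p·[0 B] lie in ι(C₂) ⊆ C′) with residue and torsion code C₁, and
-- distinct D give distinct codes because the rows of [I A; 0 B] are independent modulo p.
-- Conversely, a code C of X inside C′ has a systematic generator K ≡ G₀ (mod p); the rows of
-- (K − G₀)/p lie in ι⁻¹(C′) = C₂ and have zero leading block, so they are D·[0 B] modulo p for
-- some D, and C is the code of that D. Hence these codes are counted by the p^(k₁k₂) matrices D.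
module Submission where

open import Defs

open import Data.Bool using (Bool; true; false)
open import Data.Bool.Properties using (T-≡)
open import Data.Empty using (⊥-elim)
open import Data.Fin as Fin using (Fin; _↑ˡ_; _↑ʳ_)
import Data.Fin.Properties as Fin
open import Data.Integer as ℤ using (ℤ; +_; -[1+_]; _+_; _*_; -_; _-_)
open import Data.Integer.DivMod using (a≡a%ℕn+[a/ℕn]*n; n%ℕd<d)
open import Data.Integer.Divisibility using (_∣_)
import Data.Integer.Divisibility.Signed as Signed
import Data.Integer.Properties as ℤ
open import Algebra.Properties.CommutativeSemigroup ℤ.+-commutativeSemigroup
  using () renaming (interchange to +-interchange)
open import Data.Integer.Tactic.RingSolver using (solve-∀; solve)
open import Data.List as List using (List; []; _∷_; length)
open import Data.List.Membership.Propositional using (_∈_)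
open import Data.List.Membership.Propositional.Properties using (∈-tabulate⁺; ∈-tabulate⁻)
import Data.List.Properties as List
open import Data.List.Relation.Unary.Unique.Propositional using (Unique)
import Data.List.Relation.Unary.Unique.Propositional.Properties as Unique
open import Data.Nat as ℕ using (ℕ; zero; suc; NonZero; _^_)
open import Data.Nat.Primality using (Prime)
import Data.Nat.Properties as ℕ
open import Data.Product using (_,_; _×_; proj₁; proj₂; ∃; Σ; uncurry)
open import Data.Vec using (Vec; tabulate; lookup; map; zipWith; replicate; _[_]=_)
import Data.Vec.Functional as VF
import Data.Vec.Functional.Properties as VF
import Data.Vec.Properties as Vec
open import Function using (_∘_)
open import Function.Bundles using (_⇔_; mk⇔; Equivalence)
open import Function.Definitions using (Injective)
open import Level using (0ℓ)
open import Relation.Binary.Bundles using (Setoid)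
open import Relation.Binary.PropositionalEquality hiding ([_])
import Relation.Binary.Reasoning.Setoid
open import Relation.Nullary using (Dec; yes; no)
open import Relation.Nullary.Decidable using (⌊_⌋; toWitness; fromWitness)

-- Congruences modulo an integer

infix 4 _≡_[mod_]

-- The quotient is kept as data: several constructions below read it off.
record _≡_[mod_] (x y M : ℤ) : Set where
  constructor _,_
  field
    quotient      : ℤ
    quotient-spec : x ≡ y + quotient * M

open _≡_[mod_] public

module _ {M : ℤ} where

  ≡⇒≡-mod : ∀ {x y} → x ≡ y → x ≡ y [mod M ]
  ≡⇒≡-mod {x} refl = + 0 , solve (x ∷ M ∷ [])

  ≡-mod-refl : ∀ {x} → x ≡ x [mod M ]
  ≡-mod-refl = ≡⇒≡-mod refl

  ≡-mod-sym : ∀ {x y} → x ≡ y [mod M ] → y ≡ x [mod M ]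
  ≡-mod-sym {x} {y} (q , e) = - q , (begin
    y                     ≡⟨ solve (y ∷ q ∷ M ∷ []) ⟩
    (y + q * M) + - q * M ≡⟨ cong (λ t → t + - q * M) e ⟨
    x + - q * M           ∎)
    where open ≡-Reasoning

  ≡-mod-trans : ∀ {x y z} → x ≡ y [mod M ] → y ≡ z [mod M ] → x ≡ z [mod M ]
  ≡-mod-trans {z = z} (q , refl) (q′ , refl) = q + q′ , solve (z ∷ q ∷ q′ ∷ M ∷ [])

  +-cong-mod : ∀ {x y u v} → x ≡ y [mod M ] → u ≡ v [mod M ] → x + u ≡ y + v [mod M ]
  +-cong-mod {y = y} {v = v} (q , refl) (q′ , refl) = q + q′ , solve (y ∷ v ∷ q ∷ q′ ∷ M ∷ [])

  *-cong-mod : ∀ {x y u v} → x ≡ y [mod M ] → u ≡ v [mod M ] → x * u ≡ y * v [mod M ]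
  *-cong-mod {y = y} {v = v} (q , refl) (q′ , refl) =
    q * v + y * q′ + q * q′ * M , solve (y ∷ v ∷ q ∷ q′ ∷ M ∷ [])

  -‿cong-mod : ∀ {x y} → x ≡ y [mod M ] → - x ≡ - y [mod M ]
  -‿cong-mod {y = y} (q , refl) = - q , solve (y ∷ q ∷ M ∷ [])

  M*≡0-mod : ∀ x → M * x ≡ + 0 [mod M ]
  M*≡0-mod x = x , solve (x ∷ M ∷ [])

  ≡-mod⇒-≡0 : ∀ {x y} → x ≡ y [mod M ] → x - y ≡ + 0 [mod M ]
  ≡-mod⇒-≡0 {x} {y} x≡y = ≡-mod-trans (+-cong-mod x≡y ≡-mod-refl) (≡⇒≡-mod (ℤ.+-inverseʳ y))

  -≡0⇒≡-mod : ∀ {x y} → x - y ≡ + 0 [mod M ] → x ≡ y [mod M ]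
  -≡0⇒≡-mod {x} {y} (q , e) = q , (begin
    x               ≡⟨ solve (x ∷ y ∷ []) ⟩
    (x - y) + y     ≡⟨ cong (_+ y) e ⟩
    + 0 + q * M + y ≡⟨ solve (y ∷ q ∷ M ∷ []) ⟩
    y + q * M       ∎)
    where open ≡-Reasoning

  +-cancelˡ-mod : ∀ g {x y} → g + x ≡ g + y [mod M ] → x ≡ y [mod M ]
  +-cancelˡ-mod g {x} {y} (q , e) = q , (begin
    x                     ≡⟨ solve (g ∷ x ∷ []) ⟩
    - g + (g + x)         ≡⟨ cong (λ t → - g + t) e ⟩
    - g + (g + y + q * M) ≡⟨ solve (g ∷ y ∷ q ∷ M ∷ []) ⟩
    y + q * M             ∎)
    where open ≡-Reasoning

≡-mod-setoid : ℤ → Setoid 0ℓ 0ℓ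
≡-mod-setoid M = record
  { _≈_           = _≡_[mod M ]
  ; isEquivalence = record { refl = ≡-mod-refl ; sym = ≡-mod-sym ; trans = ≡-mod-trans }
  }

module ≡-mod-Reasoning (M : ℤ) = Relation.Binary.Reasoning.Setoid (≡-mod-setoid M)

≡-mod-scale : ∀ {M x y} c → x ≡ y [mod M ] → c * x ≡ c * y [mod c * M ]
≡-mod-scale {M} {y = y} c (q , refl) = q , solve (c ∷ y ∷ q ∷ M ∷ [])

≡-mod-*⇒≡-mod : ∀ {a b x y} → x ≡ y [mod a * b ] → x ≡ y [mod a ]
≡-mod-*⇒≡-mod {a} {b} {y = y} (q , refl) = q * b , solve (y ∷ q ∷ a ∷ b ∷ [])

≡-mod-*-cancelˡ : ∀ c .{{_ : ℤ.NonZero c}} {x y} → c * x ≡ c * y [mod c * c ] → x ≡ y [mod c ]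
≡-mod-*-cancelˡ c {x} {y} (q , e) =
  q , ℤ.*-cancelˡ-≡ c x (y + q * c) (trans e (solve (c ∷ y ∷ q ∷ [])))

∣⇒≡0-mod : ∀ {m x} → (+ m) ∣ x → x ≡ + 0 [mod + m ]
∣⇒≡0-mod m∣x with Signed.∣ᵤ⇒∣ m∣x
... | Signed.divides q x≡qm = q , trans x≡qm (sym (ℤ.+-identityˡ _))

-- Finite sums and linear combinations of rows

∑-cong : ∀ {k} {f g : Fin k → ℤ} → (∀ i → f i ≡ g i) → ∑ f ≡ ∑ g
∑-cong {zero}  f≗g = refl
∑-cong {suc k} f≗g = cong₂ _+_ (f≗g Fin.zero) (∑-cong (f≗g ∘ Fin.suc))

∑-cong-mod : ∀ {M k} {f g : Fin k → ℤ} → (∀ i → f i ≡ g i [mod M ]) → ∑ f ≡ ∑ g [mod M ]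
∑-cong-mod {k = zero}  f≡g = ≡-mod-refl
∑-cong-mod {k = suc k} f≡g = +-cong-mod (f≡g Fin.zero) (∑-cong-mod (f≡g ∘ Fin.suc))

∑-zero : ∀ {k} {f : Fin k → ℤ} → (∀ i → f i ≡ + 0) → ∑ f ≡ + 0
∑-zero {zero}  f≗0 = refl
∑-zero {suc k} f≗0 = cong₂ _+_ (f≗0 Fin.zero) (∑-zero (f≗0 ∘ Fin.suc))

∑-+ : ∀ {k} (f g : Fin k → ℤ) → ∑ (λ i → f i + g i) ≡ ∑ f + ∑ g
∑-+ {zero}  f g = refl
∑-+ {suc k} f g =
  trans (cong (λ t → f Fin.zero + g Fin.zero + t) (∑-+ (f ∘ Fin.suc) (g ∘ Fin.suc)))
        (+-interchange (f Fin.zero) (g Fin.zero) _ _)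

∑-*ˡ : ∀ {k} c (f : Fin k → ℤ) → ∑ (λ i → c * f i) ≡ c * ∑ f
∑-*ˡ {zero}  c f = sym (ℤ.*-zeroʳ c)
∑-*ˡ {suc k} c f = trans (cong (λ t → c * f Fin.zero + t) (∑-*ˡ c (f ∘ Fin.suc)))
                         (sym (ℤ.*-distribˡ-+ c (f Fin.zero) _))

I-suc : ∀ {k} (i j : Fin k) → I (suc k) (Fin.suc i) (Fin.suc j) ≡ I k i j
I-suc i j with i Fin.≟ j
... | yes _ = refl
... | no  _ = refl

∑-δʳ : ∀ {k} (f : Fin k → ℤ) i → ∑ (λ i′ → f i′ * I k i′ i) ≡ f i
∑-δʳ {suc k} f Fin.zero =
  trans (cong (λ t → f Fin.zero * + 1 + t) (∑-zero (λ i′ → ℤ.*-zeroʳ (f (Fin.suc i′)))))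
        (trans (ℤ.+-identityʳ _) (ℤ.*-identityʳ _))
∑-δʳ {suc k} f (Fin.suc i) =
  trans (cong₂ _+_ (ℤ.*-zeroʳ (f Fin.zero))
                   (trans (∑-cong (λ i′ → cong (f (Fin.suc i′) *_) (I-suc i′ i))) (∑-δʳ (f ∘ Fin.suc) i)))
        (ℤ.+-identityˡ _)

∑-δˡ : ∀ {k} (f : Fin k → ℤ) i → ∑ (λ i′ → I k i i′ * f i′) ≡ f i
∑-δˡ {suc k} f Fin.zero =
  trans (cong (λ t → + 1 * f Fin.zero + t) (∑-zero (λ i′ → ℤ.*-zeroˡ (f (Fin.suc i′)))))
        (trans (ℤ.+-identityʳ _) (ℤ.*-identityˡ _))
∑-δˡ {suc k} f (Fin.suc i) =
  trans (cong₂ _+_ (ℤ.*-zeroˡ (f Fin.zero))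
                   (trans (∑-cong (λ i′ → cong (_* f (Fin.suc i′)) (I-suc i i′))) (∑-δˡ (f ∘ Fin.suc) i)))
        (ℤ.+-identityˡ _)

∑-++ : ∀ {a b} (f : Fin (a ℕ.+ b) → ℤ) → ∑ f ≡ ∑ (λ i → f (i ↑ˡ b)) + ∑ (λ l → f (a ↑ʳ l))
∑-++ {zero}      f = sym (ℤ.+-identityˡ _)
∑-++ {suc a} {b} f = trans (cong (λ t → f Fin.zero + t) (∑-++ {a} (f ∘ Fin.suc)))
                           (sym (ℤ.+-assoc (f Fin.zero) _ _))

-- Opaque, so that coefficients and matrices left implicit are recovered by unification.
opaque
  lincomb : ∀ {k n} → (Fin k → ℤ) → Mat k n → Fin n → ℤ
  lincomb a G j = ∑ (λ i → a i * G i j)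

record Systematic {k r} (G : Mat k (k ℕ.+ r)) : Set where
  constructor systematic
  field
    leading-block : ∀ i l → G i (l ↑ˡ r) ≡ I k i l

open Systematic public

hcat-I-systematic : ∀ {k r} (A : Mat k r) → Systematic (hcat (I k) A)
hcat-I-systematic {k} {r} A = systematic λ i l → I-block i l
  where
  I-block : ∀ i l → hcat (I k) A i (l ↑ˡ r) ≡ I k i l
  I-block i l rewrite Fin.splitAt-↑ˡ k l r = refl

vcat-↑ˡ : ∀ {k l n} (P : Mat k n) (Q : Mat l n) i j → vcat P Q (i ↑ˡ l) j ≡ P i j
vcat-↑ˡ {k} {l} P Q i j rewrite Fin.splitAt-↑ˡ k i l = refl

vcat-↑ʳ : ∀ {k l n} (P : Mat k n) (Q : Mat l n) i j → vcat P Q (k ↑ʳ i) j ≡ Q i j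
vcat-↑ʳ {k} {l} P Q i j rewrite Fin.splitAt-↑ʳ k l i = refl

opaque
  unfolding lincomb

  lincomb-[] : ∀ {n} (a : Fin 0 → ℤ) (G : Mat 0 n) j → lincomb a G j ≡ + 0
  lincomb-[] a G j = refl

  lincomb-suc : ∀ {k n} (a : Fin (suc k) → ℤ) (G : Mat (suc k) n) j →
                lincomb a G j ≡ a Fin.zero * G Fin.zero j + lincomb (a ∘ Fin.suc) (G ∘ Fin.suc) j
  lincomb-suc a G j = refl

  lincomb-cong-mod : ∀ {k n} {M} {a b : Fin k → ℤ} {G H : Mat k n} →
                     (∀ i → a i ≡ b i [mod M ]) → (∀ i j → G i j ≡ H i j [mod M ]) →
                     ∀ j → lincomb a G j ≡ lincomb b H j [mod M ]
  lincomb-cong-mod a≡b G≡H j = ∑-cong-mod (λ i → *-cong-mod (a≡b i) (G≡H i j))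

  lincomb-+ : ∀ {k n} (a b : Fin k → ℤ) (G : Mat k n) j →
              lincomb (λ i → a i + b i) G j ≡ lincomb a G j + lincomb b G j
  lincomb-+ a b G j =
    trans (∑-cong (λ i → ℤ.*-distribʳ-+ (G i j) (a i) (b i))) (∑-+ (λ i → a i * G i j) (λ i → b i * G i j))

  lincomb-* : ∀ {k n} c (a : Fin k → ℤ) (G : Mat k n) j → lincomb (λ i → c * a i) G j ≡ c * lincomb a G j
  lincomb-* c a G j = trans (∑-cong (λ i → ℤ.*-assoc c (a i) (G i j))) (∑-*ˡ c (λ i → a i * G i j))

  lincomb-− : ∀ {k n} (a b : Fin k → ℤ) (G : Mat k n) j →
              lincomb (λ i → a i - b i) G j ≡ lincomb a G j - lincomb b G j
  lincomb-− a b G j = begin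
    lincomb (λ i → a i - b i) G j
      ≡⟨ ∑-cong (λ i → cong (λ t → (a i + t) * G i j) (sym (ℤ.-1*i≡-i (b i)))) ⟩
    lincomb (λ i → a i + - + 1 * b i) G j
      ≡⟨ lincomb-+ a (λ i → - + 1 * b i) G j ⟩
    lincomb a G j + lincomb (λ i → - + 1 * b i) G j
      ≡⟨ cong (λ t → lincomb a G j + t) (trans (lincomb-* (- + 1) b G j) (ℤ.-1*i≡-i _)) ⟩
    lincomb a G j - lincomb b G j
      ∎
    where open ≡-Reasoning

  lincomb-zero : ∀ {k n} (G : Mat k n) j → lincomb (λ _ → + 0) G j ≡ + 0
  lincomb-zero G j = ∑-zero (λ i → ℤ.*-zeroˡ (G i j))

  lincomb-I : ∀ {k n} (G : Mat k n) i j → lincomb (I k i) G j ≡ G i j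
  lincomb-I G i j = ∑-δˡ (λ i′ → G i′ j) i

  lincomb-vcat : ∀ {k l n} (a : Fin (k ℕ.+ l) → ℤ) (P : Mat k n) (Q : Mat l n) j →
                 lincomb a (vcat P Q) j ≡ lincomb (λ i → a (i ↑ˡ l)) P j + lincomb (λ i → a (k ↑ʳ i)) Q j
  lincomb-vcat {k} {l} a P Q j = trans (∑-++ {k} (λ i → a i * vcat P Q i j))
    (cong₂ _+_ (∑-cong (λ i → cong (λ t → a (i ↑ˡ l) * t) (vcat-↑ˡ P Q i j)))
               (∑-cong (λ i → cong (λ t → a (k ↑ʳ i) * t) (vcat-↑ʳ P Q i j))))

  lincomb-systematic : ∀ {k r} {G : Mat k (k ℕ.+ r)} → Systematic G →
                       ∀ a l → lincomb a G (l ↑ˡ r) ≡ a l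
  lincomb-systematic G-sys a l = trans (∑-cong (λ i → cong (a i *_) (leading-block G-sys i l))) (∑-δʳ a l)

  lincomb-hcat-O : ∀ {k l r} (a : Fin l → ℤ) (B : Mat l r) i → lincomb a (hcat (O l k) B) (i ↑ˡ r) ≡ + 0
  lincomb-hcat-O {k} {r = r} a B i = ∑-zero (λ i′ → trans (cong (a i′ *_) (O-block i′)) (ℤ.*-zeroʳ (a i′)))
    where
    O-block : ∀ i′ → hcat (O _ k) B i′ (i ↑ˡ r) ≡ + 0
    O-block i′ rewrite Fin.splitAt-↑ˡ k i r = refl

lincomb-vcat-bottom : ∀ {M k l n} (a : Fin (k ℕ.+ l) → ℤ) (P : Mat k n) (Q : Mat l n) →
                      (∀ i → a (i ↑ˡ l) ≡ + 0 [mod M ]) →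
                      ∀ j → lincomb a (vcat P Q) j ≡ lincomb (λ i → a (k ↑ʳ i)) Q j [mod M ]
lincomb-vcat-bottom a P Q top≡0 j = ≡-mod-trans (≡⇒≡-mod (lincomb-vcat a P Q j))
  (≡-mod-trans (+-cong-mod (lincomb-cong-mod top≡0 (λ _ _ → ≡-mod-refl) j) ≡-mod-refl)
               (≡⇒≡-mod (trans (cong (_+ lincomb _ Q j) (lincomb-zero P j)) (ℤ.+-identityˡ _))))

lincomb-vcat-leading : ∀ {k l r} {P : Mat k (k ℕ.+ r)} → Systematic P → ∀ (B : Mat l r) a i →
                       lincomb a (vcat P (hcat (O l k) B)) (i ↑ˡ r) ≡ a (i ↑ˡ l)
lincomb-vcat-leading {k} {l} {r} {P} P-sys B a i = begin
  lincomb a (vcat P (hcat (O l k) B)) (i ↑ˡ r)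
    ≡⟨ lincomb-vcat a P (hcat (O l k) B) (i ↑ˡ r) ⟩
  lincomb (λ i → a (i ↑ˡ l)) P (i ↑ˡ r) + lincomb (λ i → a (k ↑ʳ i)) (hcat (O l k) B) (i ↑ˡ r)
    ≡⟨ cong₂ _+_ (lincomb-systematic P-sys (λ i → a (i ↑ˡ l)) i) (lincomb-hcat-O (λ i → a (k ↑ʳ i)) B i) ⟩
  a (i ↑ˡ l) + + 0
    ≡⟨ ℤ.+-identityʳ _ ⟩
  a (i ↑ˡ l) ∎
  where open ≡-Reasoning

-- Words over Z_m as reductions of integer vectors

Vec-ext : ∀ {A : Set} {n} {xs ys : Vec A n} → (∀ j → lookup xs j ≡ lookup ys j) → xs ≡ ys
Vec-ext {xs = xs} {ys} xs≗ys =
  trans (sym (Vec.tabulate∘lookup xs)) (trans (Vec.tabulate-cong xs≗ys) (Vec.tabulate∘lookup ys))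

opaque
  word : ∀ {n} (m : ℕ) .{{_ : NonZero m}} → (Fin n → ℤ) → Word m n
  word m v = tabulate (λ j → [ m ] v j)

repr : ∀ {m n} → Word m n → Fin n → ℤ
repr x j = ⟦ lookup x j ⟧

private
  ≡+*⇒≡ : ∀ {m r s} k → r ℕ.< m → + r ≡ + s + + k * + m → r ≡ s
  ≡+*⇒≡ {m} {r} {s} k r<m e with k | ℤ.+-injective (trans e (cong (λ t → + s + t) (sym (ℤ.pos-* k m))))
  ... | zero  | r≡s+0 = trans r≡s+0 (ℕ.+-identityʳ s)
  ... | suc _ | r≡s+km =
    ⊥-elim (ℕ.<⇒≱ r<m (subst (m ℕ.≤_) (sym r≡s+km) (ℕ.≤-trans (ℕ.m≤m+n m _) (ℕ.m≤n+m _ s))))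

toℕ-≡-mod⇒≡ : ∀ {m r s} → r ℕ.< m → s ℕ.< m → + r ≡ + s [mod + m ] → r ≡ s
toℕ-≡-mod⇒≡ r<m s<m (+ k , e)       = ≡+*⇒≡ k r<m e
toℕ-≡-mod⇒≡ r<m s<m r≡s@(-[1+ k ] , _) = sym (≡+*⇒≡ (suc k) s<m (quotient-spec (≡-mod-sym r≡s)))

module _ {m : ℕ} .{{_ : NonZero m}} where

  ⟦[]⟧≡-mod : ∀ x → ⟦ [ m ] x ⟧ ≡ x [mod + m ]
  ⟦[]⟧≡-mod x = ≡-mod-sym (x ℤ./ℕ m , trans (a≡a%ℕn+[a/ℕn]*n x m)
    (cong (λ t → + t + (x ℤ./ℕ m) * + m) (sym (Fin.toℕ-fromℕ< (n%ℕd<d x m)))))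

  ≡-mod⇒Fin-≡ : ∀ {a b : Fin m} → ⟦ a ⟧ ≡ ⟦ b ⟧ [mod + m ] → a ≡ b
  ≡-mod⇒Fin-≡ {a} {b} a≡b = Fin.toℕ-injective (toℕ-≡-mod⇒≡ (Fin.toℕ<n a) (Fin.toℕ<n b) a≡b)

  []-cong-mod : ∀ {x y} → x ≡ y [mod + m ] → [ m ] x ≡ [ m ] y
  []-cong-mod {x} {y} x≡y = ≡-mod⇒Fin-≡ (≡-mod-trans (⟦[]⟧≡-mod x) (≡-mod-trans x≡y (≡-mod-sym (⟦[]⟧≡-mod y))))

  []-⟦⟧ : ∀ (a : Fin m) → [ m ] ⟦ a ⟧ ≡ a
  []-⟦⟧ a = ≡-mod⇒Fin-≡ (⟦[]⟧≡-mod ⟦ a ⟧)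

  opaque
    unfolding word lincomb

    aG≡word : ∀ {k n} (G : Mat k n) a → aG m G a ≡ word m (lincomb a G)
    aG≡word G a = refl

    lookup-word : ∀ {n} (v : Fin n → ℤ) j → lookup (word m v) j ≡ [ m ] v j
    lookup-word v j = Vec.lookup∘tabulate _ j

    repr-word : ∀ {n} (v : Fin n → ℤ) j → repr (word m v) j ≡ v j [mod + m ]
    repr-word v j = ≡-mod-trans (≡⇒≡-mod (cong ⟦_⟧ (lookup-word v j))) (⟦[]⟧≡-mod (v j))

    word-repr : ∀ {n} (x : Word m n) → word m (repr x) ≡ x
    word-repr x = Vec-ext (λ j → trans (lookup-word (repr x) j) ([]-⟦⟧ (lookup x j)))

    word-cong-mod : ∀ {n} {v w : Fin n → ℤ} → (∀ j → v j ≡ w j [mod + m ]) → word m v ≡ word m w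
    word-cong-mod v≡w = Vec.tabulate-cong (λ j → []-cong-mod (v≡w j))

    word-zero : ∀ {n} → replicate n ([ m ] (+ 0)) ≡ word m (λ _ → + 0)
    word-zero = Vec-ext (λ j → trans (Vec.lookup-replicate j _) (sym (lookup-word (λ _ → + 0) j)))

    word-+ : ∀ {n} (v w : Fin n → ℤ) →
             zipWith (λ a b → [ m ] (⟦ a ⟧ + ⟦ b ⟧)) (word m v) (word m w) ≡ word m (λ j → v j + w j)
    word-+ v w = Vec-ext λ j → begin
      lookup (zipWith _ (word m v) (word m w)) j    ≡⟨ Vec.lookup-zipWith _ j (word m v) (word m w) ⟩
      [ m ] (repr (word m v) j + repr (word m w) j) ≡⟨ []-cong-mod (+-cong-mod (repr-word v j) (repr-word w j)) ⟩
      [ m ] (v j + w j)                             ≡⟨ lookup-word (λ j → v j + w j) j ⟨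
      lookup (word m (λ j → v j + w j)) j           ∎
      where open ≡-Reasoning

    word-* : ∀ {n} c (v : Fin n → ℤ) → map (λ a → [ m ] (c * ⟦ a ⟧)) (word m v) ≡ word m (λ j → c * v j)
    word-* c v = Vec-ext λ j → begin
      lookup (map _ (word m v)) j       ≡⟨ Vec.lookup-map j _ (word m v) ⟩
      [ m ] (c * repr (word m v) j)     ≡⟨ []-cong-mod (*-cong-mod (≡-mod-refl {x = c}) (repr-word v j)) ⟩
      [ m ] (c * v j)                   ≡⟨ lookup-word (λ j → c * v j) j ⟨
      lookup (word m (λ j → c * v j)) j ∎
      where open ≡-Reasoning

  word-injective-mod : ∀ {n} {v w : Fin n → ℤ} → word m v ≡ word m w → ∀ j → v j ≡ w j [mod + m ]
  word-injective-mod {v = v} {w} e j =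
    ≡-mod-trans (≡-mod-sym (repr-word v j)) (≡-mod-trans (≡⇒≡-mod (cong (λ x → repr x j) e)) (repr-word w j))

module _ {m n} .{{_ : NonZero m}} {C : Code m n} (C-code : IsCode m C) where
  open IsCode C-code

  ∈C-cong-mod : ∀ {v w : Fin n → ℤ} → (∀ j → v j ≡ w j [mod + m ]) → word m v ∈C C → word m w ∈C C
  ∈C-cong-mod v≡w = subst (_∈C C) (word-cong-mod v≡w)

  ∈C-zero : word m (λ _ → + 0) ∈C C
  ∈C-zero = subst (_∈C C) word-zero has-zero

  ∈C-+ : ∀ {v w : Fin n → ℤ} → word m v ∈C C → word m w ∈C C → word m (λ j → v j + w j) ∈C C
  ∈C-+ {v} {w} v∈C w∈C = subst (_∈C C) (word-+ v w) (add-closed (word m v) (word m w) v∈C w∈C)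

  ∈C-* : ∀ c {v : Fin n → ℤ} → word m v ∈C C → word m (λ j → c * v j) ∈C C
  ∈C-* c {v} v∈C = subst (_∈C C) (word-* c v) (scal-closed c (word m v) v∈C)

  ∈C-− : ∀ {v w : Fin n → ℤ} → word m v ∈C C → word m w ∈C C → word m (λ j → v j - w j) ∈C C
  ∈C-− {v} {w} v∈C w∈C = ∈C-cong-mod (λ j → ≡⇒≡-mod (cong (λ t → v j + t) (ℤ.-1*i≡-i (w j))))
                                     (∈C-+ v∈C (∈C-* (- + 1) w∈C))

  ∈C-lincomb : ∀ {k} {G : Mat k n} → (∀ i → word m (G i) ∈C C) → ∀ a → word m (lincomb a G) ∈C C
  ∈C-lincomb {zero}  {G} G∈C a = subst (_∈C C) (word-cong-mod (λ j → ≡⇒≡-mod (sym (lincomb-[] a G j)))) ∈C-zero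
  ∈C-lincomb {suc k} {G} G∈C a = subst (_∈C C) (word-cong-mod (λ j → ≡⇒≡-mod (sym (lincomb-suc a G j))))
    (∈C-+ (∈C-* (a Fin.zero) (G∈C Fin.zero)) (∈C-lincomb (G∈C ∘ Fin.suc) (a ∘ Fin.suc)))

decode : ∀ {m n} → Fin (m ^ n) → Word m n
decode i = tabulate (Fin.finToFun i)

encode-tabulate : ∀ {m n} (f : Fin n → Fin m) → encode (tabulate f) ≡ Fin.funToFin f
encode-tabulate {n = zero}  f = refl
encode-tabulate {n = suc n} f = cong (Fin.combine (f Fin.zero)) (encode-tabulate (f ∘ Fin.suc))

encode-decode : ∀ {m n} (i : Fin (m ^ n)) → encode {m} {n} (decode i) ≡ i
encode-decode {m} {n} i = trans (encode-tabulate {m} {n} (Fin.finToFun i)) (Fin.funToFin-finToFin {n} i)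

decode-encode : ∀ {m n} (x : Word m n) → decode (encode x) ≡ x
decode-encode x = begin
  tabulate (Fin.finToFun (encode x))                       ≡⟨ cong (tabulate ∘ Fin.finToFun) encode-x ⟩
  tabulate (Fin.finToFun (Fin.funToFin (lookup x)))        ≡⟨ Vec.tabulate-cong (Fin.finToFun-funToFin (lookup x)) ⟩
  tabulate (lookup x)                                      ≡⟨ Vec.tabulate∘lookup x ⟩
  x                                                        ∎
  where
  open ≡-Reasoning
  encode-x : encode x ≡ Fin.funToFin (lookup x)
  encode-x = trans (cong encode (sym (Vec.tabulate∘lookup x))) (encode-tabulate (lookup x))

codeOf : ∀ {m n} (P : Word m n → Set) → (∀ x → Dec (P x)) → Code m n
codeOf P P? = mkCode (tabulate (λ i → ⌊ P? (decode i) ⌋))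

∈-codeOf : ∀ {m n} (P : Word m n → Set) (P? : ∀ x → Dec (P x)) x → (x ∈C codeOf P P?) ⇔ P x
∈-codeOf P P? x = mk⇔
  (λ x∈ → subst P (decode-encode x)
            (toWitness {a? = P? x′} (Equivalence.from T-≡ (trans (sym bit) (Vec.[]=⇒lookup x∈)))))
  (λ Px → Vec.lookup⇒[]= (encode x) _
            (trans bit (Equivalence.to T-≡ (fromWitness {a? = P? x′} (subst P (sym (decode-encode x)) Px)))))
  where
  x′ = decode (encode x)
  bit : lookup (Code.chars (codeOf P P?)) (encode x) ≡ ⌊ P? x′ ⌋
  bit = Vec.lookup∘tabulate _ (encode x)

⊆C-antisym : ∀ {m n} {C D : Code m n} → C ⊆C D → D ⊆C C → C ≡ D
⊆C-antisym {m} {n} {mkCode s} {mkCode t} C⊆D D⊆C = cong mkCode (Vec-ext same-bit)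
  where
  ∈⇔bit : ∀ (u : Vec Bool (m ^ n)) i → (decode {m} {n} i ∈C mkCode u) ⇔ (lookup u i ≡ true)
  ∈⇔bit u i = mk⇔ (λ dᵢ∈ → Vec.[]=⇒lookup (subst (λ e → u [ e ]= true) (encode-decode {m} {n} i) dᵢ∈))
                  (λ uᵢ → subst (λ e → u [ e ]= true) (sym (encode-decode {m} {n} i)) (Vec.lookup⇒[]= i u uᵢ))
  bool-ext : ∀ {a b : Bool} → (a ≡ true → b ≡ true) → (b ≡ true → a ≡ true) → a ≡ b
  bool-ext {false} {false} _   _   = refl
  bool-ext {false} {true}  _   b⇒a = b⇒a refl
  bool-ext {true}          a⇒b _   = sym (a⇒b refl)
  same-bit : ∀ i → lookup s i ≡ lookup t i
  same-bit i = bool-ext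
    (λ sᵢ → Equivalence.to (∈⇔bit t i) (C⊆D (decode {m} {n} i) (Equivalence.from (∈⇔bit s i) sᵢ)))
    (λ tᵢ → Equivalence.to (∈⇔bit s i) (D⊆C (decode {m} {n} i) (Equivalence.from (∈⇔bit t i) tᵢ)))

Fin-injective⇒surjective : ∀ {n} (f : Fin n → Fin n) → Injective _≡_ _≡_ f → ∀ y → ∃ λ x → f x ≡ y
Fin-injective⇒surjective {suc n} f f-inj y with Fin.any? (λ x → f x Fin.≟ y)
... | yes hit = hit
... | no miss = ⊥-elim (ℕ.<-irrefl refl (Fin.injective⇒≤ punched-injective))
  where
  y≢f : ∀ x → y ≢ f x
  y≢f x y≡fx = miss (x , sym y≡fx)
  punched : Fin (suc n) → Fin n
  punched x = Fin.punchOut (y≢f x)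
  punched-injective : Injective _≡_ _≡_ punched
  punched-injective {x} {x′} = f-inj ∘ Fin.punchOut-injective (y≢f x) (y≢f x′)

Fin-surjective⇒injective : ∀ {n} (f : Fin n → Fin n) → (∀ y → ∃ λ x → f x ≡ y) → Injective _≡_ _≡_ f
Fin-surjective⇒injective f f-surj {x} {y} fx≡fy =
  trans (sym (g∘f x)) (trans (cong g fx≡fy) (g∘f y))
  where
  g : Fin _ → Fin _
  g y = proj₁ (f-surj y)
  f∘g : ∀ y → f (g y) ≡ y
  f∘g y = proj₂ (f-surj y)
  g∘f : ∀ x → g (f x) ≡ x
  g∘f x with Fin-injective⇒surjective g (λ gx≡gy → trans (sym (f∘g _)) (trans (cong f gx≡gy) (f∘g _))) x
  ... | x′ , refl = cong g (f∘g x′)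

Word-surjective⇒injective : ∀ {m d} (h : Word m d → Word m d) → (∀ y → ∃ λ x → h x ≡ y) → Injective _≡_ _≡_ h
Word-surjective⇒injective {m} {d} h h-surj {x} {y} hx≡hy =
  trans (sym (decode-encode x)) (trans (cong decode encode-x≡encode-y) (decode-encode y))
  where
  f : Fin (m ^ d) → Fin (m ^ d)
  f = encode ∘ h ∘ decode
  f∘encode : ∀ x → f (encode x) ≡ encode (h x)
  f∘encode x = cong (encode ∘ h) (decode-encode x)
  f-surj : ∀ i → ∃ λ j → f j ≡ i
  f-surj i with h-surj (decode i)
  ... | x , hx≡ = encode x , trans (f∘encode x) (trans (cong encode hx≡) (encode-decode {m} {d} i))
  encode-x≡encode-y : encode x ≡ encode y
  encode-x≡encode-y = Fin-surjective⇒injective f f-surj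
    (trans (f∘encode x) (trans (cong encode hx≡hy) (sym (f∘encode y))))

module _ {m k l : ℕ} where

  matrixOf : Fin (m ^ (k ℕ.* l)) → Fin k → Fin l → Fin m
  matrixOf t i j = lookup (decode t) (Fin.combine i j)

  matrixOf-injective : ∀ {t t′} → (∀ i j → matrixOf t i j ≡ matrixOf t′ i j) → t ≡ t′
  matrixOf-injective {t} {t′} t≗t′ =
    trans (sym (encode-decode {m} {k ℕ.* l} t))
      (trans (cong encode (Vec-ext {xs = decode t} {decode t′} same-entry)) (encode-decode {m} {k ℕ.* l} t′))
    where
    same-entry : ∀ q → lookup (decode t) q ≡ lookup (decode t′) q
    same-entry q with Fin.combine-surjective {m = k} {n = l} q
    ... | i , j , refl = t≗t′ i j

  matrixOf-surjective : ∀ (M : Fin k → Fin l → Fin m) → ∃ λ t → ∀ i j → matrixOf t i j ≡ M i j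
  matrixOf-surjective M = encode entries , λ i j → begin
    lookup (decode (encode entries)) (Fin.combine i j) ≡⟨ cong (λ x → lookup x _) (decode-encode entries) ⟩
    lookup entries (Fin.combine i j)                   ≡⟨ Vec.lookup∘tabulate _ (Fin.combine i j) ⟩
    uncurry M (Fin.remQuot l (Fin.combine i j))        ≡⟨ cong (uncurry M) (Fin.remQuot-combine i j) ⟩
    M i j                                              ∎
    where
    open ≡-Reasoning
    entries : Word m (k ℕ.* l)
    entries = tabulate (λ q → uncurry M (Fin.remQuot l q))

-- Generator matrices

module _ {m n k} .{{_ : NonZero m}} {C : Code m n} {G : Mat k n} (G-gen : HasGenerator m C G) where

  generator-∈ : ∀ a → word m (lincomb a G) ∈C C
  generator-∈ a = Equivalence.from (G-gen _) (a , sym (aG≡word G a))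

  generator-coefficients : ∀ {x} → x ∈C C → ∃ λ a → x ≡ word m (lincomb a G)
  generator-coefficients {x} x∈C with Equivalence.to (G-gen x) x∈C
  ... | a , x≡aG = a , trans x≡aG (aG≡word G a)

module _ {m n d} .{{_ : NonZero m}} {C : Code m n} (C-code : IsCode m C) {G : Mat d n}
         (G-gen : HasGenerator m C G) (C-dim : HasDim m C d) where

  private
    basis : Fin d → Word m n
    basis = proj₁ C-dim

    B : Mat d n
    B i = repr (basis i)

    basis∈C : ∀ i → word m (B i) ∈C C
    basis∈C i = subst (_∈C C) (sym (word-repr (basis i))) (proj₁ (proj₂ C-dim) i)

    basis-independent : ∀ {u v : Fin d → ℤ} → word m (lincomb u B) ≡ word m (lincomb v B) →
                        ∀ i → u i ≡ v i [mod + m ]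
    basis-independent {u} {v} uB≡vB i =
      -≡0⇒≡-mod (∣⇒≡0-mod (proj₁ (proj₂ (proj₂ C-dim)) (λ i → u i - v i) [u-v]B≡0 i))
      where
      [u-v]B≡0 : aG m B (λ i → u i - v i) ≡ replicate n ([ m ] (+ 0))
      [u-v]B≡0 = trans (aG≡word B (λ i → u i - v i)) (trans (word-cong-mod (λ j →
        ≡-mod-trans (≡⇒≡-mod (lincomb-− u v B j)) (≡-mod⇒-≡0 (word-injective-mod uB≡vB j)))) (sym word-zero))

    coordinates : ∀ x → x ∈C C → Fin d → ℤ
    coordinates x x∈C = proj₁ (proj₂ (proj₂ (proj₂ C-dim)) x x∈C)

    coordinates-spec : ∀ x (x∈C : x ∈C C) → x ≡ word m (lincomb (coordinates x x∈C) B)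
    coordinates-spec x x∈C =
      trans (proj₂ (proj₂ (proj₂ (proj₂ C-dim)) x x∈C)) (aG≡word B (coordinates x x∈C))

    coordinates-unique : ∀ {u} x (x∈C : x ∈C C) → x ≡ word m (lincomb u B) →
                         word m (coordinates x x∈C) ≡ word m u
    coordinates-unique x x∈C x≡uB =
      word-cong-mod (basis-independent (trans (sym (coordinates-spec x x∈C)) x≡uB))

    generated : (Fin d → ℤ) → Word m n
    generated a = word m (lincomb a G)

    generated-∈ : ∀ a → generated a ∈C C
    generated-∈ = generator-∈ G-gen

    generated-repr : ∀ a → generated (repr (word m a)) ≡ generated a
    generated-repr a = word-cong-mod (lincomb-cong-mod (repr-word a) (λ _ _ → ≡-mod-refl))

    -- Sends G-coordinates to basis coordinates; being onto, it is one-to-one by counting.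
    change-of-basis : Word m d → Word m d
    change-of-basis t = word m (coordinates (generated (repr t)) (generated-∈ (repr t)))

    change-of-basis-surjective : ∀ s → ∃ λ t → change-of-basis t ≡ s
    change-of-basis-surjective s = word m a , (begin
      change-of-basis (word m a) ≡⟨ coordinates-unique (generated (repr (word m a))) (generated-∈ (repr (word m a)))
                                      (trans (generated-repr a) (sym sB≡aG)) ⟩
      word m (repr s)            ≡⟨ word-repr s ⟩
      s                          ∎)
      where
      open ≡-Reasoning
      sB∈C : word m (lincomb (repr s) B) ∈C C
      sB∈C = ∈C-lincomb C-code basis∈C (repr s)
      a : Fin d → ℤ
      a = proj₁ (generator-coefficients G-gen sB∈C)
      sB≡aG : word m (lincomb (repr s) B) ≡ generated a
      sB≡aG = proj₂ (generator-coefficients G-gen sB∈C)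

  generator-rows-independent : ∀ c → (∀ j → lincomb c G j ≡ + 0 [mod + m ]) → ∀ i → c i ≡ + 0 [mod + m ]
  generator-rows-independent c cG≡0 i = ≡-mod-trans (≡-mod-sym (repr-word c i))
    (≡-mod-trans (≡⇒≡-mod (cong (λ t → repr t i) c≡0)) (repr-word (λ _ → + 0) i))
    where
    zero-word : Word m d
    zero-word = word m (λ _ → + 0)
    cG≡0G : generated (repr (word m c)) ≡ generated (repr zero-word)
    cG≡0G = trans (generated-repr c) (trans (word-cong-mod (λ j →
      ≡-mod-trans (cG≡0 j) (≡-mod-sym (≡⇒≡-mod (lincomb-zero G j))))) (sym (generated-repr (λ _ → + 0))))
    c≡0 : word m c ≡ zero-word
    c≡0 = Word-surjective⇒injective change-of-basis change-of-basis-surjective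
      (coordinates-unique (generated (repr (word m c))) (generated-∈ (repr (word m c)))
        (trans cG≡0G (coordinates-spec (generated (repr zero-word)) (generated-∈ (repr zero-word)))))

-- Spans of systematic matrices

leading : ∀ {m k r} → Word m (k ℕ.+ r) → Fin k → ℤ
leading {r = r} x l = repr x (l ↑ˡ r)

-- A word lies in the span of a systematic G iff it is the combination of the rows of G whose
-- coefficients are its own leading entries; this makes membership decidable.
LeadingCombination : ∀ {k r} (m : ℕ) .{{_ : NonZero m}} → Mat k (k ℕ.+ r) → Word m (k ℕ.+ r) → Set
LeadingCombination m G x = x ≡ word m (lincomb (leading x) G)

leadingCombination? : ∀ {k r} (m : ℕ) .{{_ : NonZero m}} (G : Mat k (k ℕ.+ r)) x → Dec (LeadingCombination m G x)
leadingCombination? m G x = Vec.≡-dec Fin._≟_ x (word m (lincomb (leading x) G))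

opaque
  span : ∀ {k r} (m : ℕ) .{{_ : NonZero m}} → Mat k (k ℕ.+ r) → Code m (k ℕ.+ r)
  span m G = codeOf (LeadingCombination m G) (leadingCombination? m G)

  ∈-span⇔leading : ∀ {k r} {m : ℕ} .{{_ : NonZero m}} {G : Mat k (k ℕ.+ r)} x →
                   (x ∈C span m G) ⇔ LeadingCombination m G x
  ∈-span⇔leading {m = m} {G} = ∈-codeOf (LeadingCombination m G) (leadingCombination? m G)

module _ {m k r} .{{_ : NonZero m}} {G : Mat k (k ℕ.+ r)} (G-sys : Systematic G) where

  leading-word-lincomb : ∀ a l → leading (word m (lincomb a G)) l ≡ a l [mod + m ]
  leading-word-lincomb a l = ≡-mod-trans (repr-word (lincomb a G) (l ↑ˡ r)) (≡⇒≡-mod (lincomb-systematic G-sys a l))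

  ∈-span⇔ : ∀ x → (x ∈C span m G) ⇔ (∃ λ a → x ≡ word m (lincomb a G))
  ∈-span⇔ x = mk⇔ (λ x∈ → leading x , Equivalence.to (∈-span⇔leading {G = G} x) x∈) (λ (a , x≡aG) → ∈-span a x≡aG)
    where
    ∈-span : ∀ a {x} → x ≡ word m (lincomb a G) → x ∈C span m G
    ∈-span a refl = Equivalence.from (∈-span⇔leading {G = G} _)
      (word-cong-mod (lincomb-cong-mod (λ l → ≡-mod-sym (leading-word-lincomb a l)) (λ _ _ → ≡-mod-refl)))

  word-lincomb-∈-span : ∀ a → word m (lincomb a G) ∈C span m G
  word-lincomb-∈-span a = Equivalence.from (∈-span⇔ _) (a , refl)

  span-IsCode : IsCode m (span m G)
  span-IsCode = record
    { has-zero    = ∈-span-by (λ _ → + 0) (trans word-zero (word-cong-mod (λ j → ≡⇒≡-mod (sym (lincomb-zero G j)))))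
    ; add-closed  = λ x y x∈ y∈ → add (Equivalence.to (∈-span⇔ x) x∈) (Equivalence.to (∈-span⇔ y) y∈)
    ; scal-closed = λ c x x∈ → scale c (Equivalence.to (∈-span⇔ x) x∈)
    }
    where
    ∈-span-by : ∀ a {x} → x ≡ word m (lincomb a G) → x ∈C span m G
    ∈-span-by a x≡aG = Equivalence.from (∈-span⇔ _) (a , x≡aG)
    add : ∀ {x y} → (∃ λ a → x ≡ word m (lincomb a G)) → (∃ λ b → y ≡ word m (lincomb b G)) →
          zipWith (λ a b → [ m ] (⟦ a ⟧ + ⟦ b ⟧)) x y ∈C span m G
    add (a , refl) (b , refl) = ∈-span-by (λ i → a i + b i)
      (trans (word-+ (lincomb a G) (lincomb b G)) (word-cong-mod (λ j → ≡⇒≡-mod (sym (lincomb-+ a b G j)))))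
    scale : ∀ c {x} → (∃ λ a → x ≡ word m (lincomb a G)) → map (λ a → [ m ] (c * ⟦ a ⟧)) x ∈C span m G
    scale c (a , refl) = ∈-span-by (λ i → c * a i)
      (trans (word-* c (lincomb a G)) (word-cong-mod (λ j → ≡⇒≡-mod (sym (lincomb-* c a G j)))))

  row-∈-span : ∀ i → word m (G i) ∈C span m G
  row-∈-span i = subst (_∈C span m G) (word-cong-mod (λ j → ≡⇒≡-mod (lincomb-I G i j))) (word-lincomb-∈-span (I k i))

  span-⊆C : ∀ {C : Code m (k ℕ.+ r)} → IsCode m C → (∀ i → word m (G i) ∈C C) → span m G ⊆C C
  span-⊆C C-code G∈C x x∈ with Equivalence.to (∈-span⇔ x) x∈
  ... | a , refl = ∈C-lincomb C-code G∈C a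

  row-∈-span-≡-mod : ∀ {v : Fin (k ℕ.+ r) → ℤ} i → (∀ l → v (l ↑ˡ r) ≡ I k i l) → word m v ∈C span m G →
                     ∀ j → v j ≡ G i j [mod + m ]
  row-∈-span-≡-mod {v} i v-leading v∈ j with Equivalence.to (∈-span⇔ _) v∈
  ... | a , v≡aG = ≡-mod-trans (word-injective-mod v≡aG j)
                     (≡-mod-trans (lincomb-cong-mod {G = G} a≡eᵢ (λ _ _ → ≡-mod-refl) j) (≡⇒≡-mod (lincomb-I G i j)))
    where
    a≡eᵢ : ∀ l → a l ≡ I k i l [mod + m ]
    a≡eᵢ l = ≡-mod-trans (≡-mod-sym (leading-word-lincomb a l))
               (≡-mod-trans (≡⇒≡-mod (cong (λ x → leading x l) (sym v≡aG)))
                 (≡-mod-trans (repr-word v (l ↑ˡ r)) (≡⇒≡-mod (v-leading l))))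

span-injective-mod : ∀ {m k r} .{{_ : NonZero m}} {G H : Mat k (k ℕ.+ r)} → Systematic G → Systematic H →
                     span m G ≡ span m H → ∀ i j → G i j ≡ H i j [mod + m ]
span-injective-mod {m = m} {G = G} G-sys H-sys G≡H i =
  row-∈-span-≡-mod H-sys i (leading-block G-sys i) (subst (word m (G i) ∈C_) G≡H (row-∈-span G-sys i))

span-cong-mod : ∀ {m k r} .{{_ : NonZero m}} {G H : Mat k (k ℕ.+ r)} → Systematic G → Systematic H →
                (∀ i j → G i j ≡ H i j [mod + m ]) → span m G ≡ span m H
span-cong-mod {m = m} {G = G} {H} G-sys H-sys G≡H = ⊆C-antisym
  (span-⊆C G-sys (span-IsCode H-sys)
    (λ i → subst (_∈C span m H) (word-cong-mod (λ j → ≡-mod-sym (G≡H i j))) (row-∈-span H-sys i)))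
  (span-⊆C H-sys (span-IsCode G-sys)
    (λ i → subst (_∈C span m G) (word-cong-mod (G≡H i)) (row-∈-span G-sys i)))

-- Codes over Z_(p²) and their residue and torsion codes

module _ {p : ℕ} .{{_ : NonZero p}} where

  ≡-mod-p²⇒≡-mod-p : ∀ {x y} → x ≡ y [mod + (p ℕ.* p) ] → x ≡ y [mod + p ]
  ≡-mod-p²⇒≡-mod-p {x} {y} x≡y = ≡-mod-*⇒≡-mod (subst (x ≡ y [mod_]) (ℤ.pos-* p p) x≡y)

  p*-cong-mod : ∀ {x y} → x ≡ y [mod + p ] → + p * x ≡ + p * y [mod + (p ℕ.* p) ]
  p*-cong-mod {x} {y} x≡y = subst (+ p * x ≡ + p * y [mod_]) (sym (ℤ.pos-* p p)) (≡-mod-scale (+ p) x≡y)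

  p*-cancel-mod : ∀ {x y} → + p * x ≡ + p * y [mod + (p ℕ.* p) ] → x ≡ y [mod + p ]
  p*-cancel-mod {x} {y} px≡py = ≡-mod-*-cancelˡ (+ p) (subst (+ p * x ≡ + p * y [mod_]) (ℤ.pos-* p p) px≡py)

  π-word : ∀ {n} (v : Fin n → ℤ) → π p (word (p ℕ.* p) v) ≡ word p v
  π-word v = Vec-ext λ j → begin
    lookup (π p (word (p ℕ.* p) v)) j ≡⟨ Vec.lookup-map j _ (word (p ℕ.* p) v) ⟩
    [ p ] repr (word (p ℕ.* p) v) j   ≡⟨ []-cong-mod (≡-mod-p²⇒≡-mod-p (repr-word v j)) ⟩
    [ p ] v j                         ≡⟨ lookup-word v j ⟨
    lookup (word p v) j               ∎
    where open ≡-Reasoning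

  ι-word : ∀ {n} (v : Fin n → ℤ) → ι p (word p v) ≡ word (p ℕ.* p) (λ j → + p * v j)
  ι-word v = Vec-ext λ j → begin
    lookup (ι p (word p v)) j             ≡⟨ Vec.lookup-map j _ (word p v) ⟩
    [ p ℕ.* p ] (+ p * repr (word p v) j) ≡⟨ []-cong-mod (p*-cong-mod (repr-word v j)) ⟩
    [ p ℕ.* p ] (+ p * v j)               ≡⟨ lookup-word (λ j → + p * v j) j ⟨
    lookup (word (p ℕ.* p) (λ j → + p * v j)) j ∎
    where open ≡-Reasoning

  module _ {n} {D : Code (p ℕ.* p) n} {E : Code p n} where

    preimage-∈ : PreimageIs p D E → ∀ {v} → word p v ∈C E → word (p ℕ.* p) (λ j → + p * v j) ∈C D
    preimage-∈ D-pre {v} v∈E = subst (_∈C D) (ι-word v) (Equivalence.to (D-pre (word p v)) v∈E)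

    preimage-∈⁻¹ : PreimageIs p D E → ∀ {v} → word (p ℕ.* p) (λ j → + p * v j) ∈C D → word p v ∈C E
    preimage-∈⁻¹ D-pre {v} pv∈D = Equivalence.from (D-pre (word p v)) (subst (_∈C D) (sym (ι-word v)) pv∈D)

    image-∈ : ImageIs p D E → ∀ {v} → word (p ℕ.* p) v ∈C D → word p v ∈C E
    image-∈ D-im {v} v∈D = subst (_∈C E) (π-word v) (Equivalence.from (D-im _) (word (p ℕ.* p) v , v∈D , refl))

    image-lift : ImageIs p D E → ∀ {v} → word p v ∈C E →
                 ∃ λ w → word (p ℕ.* p) w ∈C D × ∀ j → w j ≡ v j [mod + p ]
    image-lift D-im {v} v∈E with Equivalence.to (D-im (word p v)) v∈E
    ... | c , c∈D , πc≡v = repr c , subst (_∈C D) (sym (word-repr c)) c∈D ,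
                             word-injective-mod (trans (sym (π-word (repr c))) (trans (cong (π p) (word-repr c)) πc≡v))

  -- x differs from a lift in D of π(x) by p times a word of the torsion code.
  ⊆-same-residue-torsion⇒⊇ : ∀ {n} {C₁ : Code p n} {D E : Code (p ℕ.* p) n} →
                              IsCode (p ℕ.* p) D → IsCode (p ℕ.* p) E → D ⊆C E →
                              ImageIs p D C₁ → ImageIs p E C₁ → PreimageIs p D C₁ → PreimageIs p E C₁ → E ⊆C D
  ⊆-same-residue-torsion⇒⊇ {n} {C₁} {D} {E} D-code E-code D⊆E D-im E-im D-pre E-pre x x∈E =
    subst (_∈C D) (word-repr x) (∈C-cong-mod D-code (λ j → ≡⇒≡-mod (sym (X≡d+pW j))) (∈C-+ D-code d∈D pW∈D))
    where
    a+b-a≡b : ∀ a b → a + b - a ≡ b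
    a+b-a≡b = solve-∀
    X : Fin n → ℤ
    X = repr x
    X∈E : word (p ℕ.* p) X ∈C E
    X∈E = subst (_∈C E) (sym (word-repr x)) x∈E
    lift : ∃ λ d → word (p ℕ.* p) d ∈C D × ∀ j → d j ≡ X j [mod + p ]
    lift = image-lift D-im (image-∈ E-im X∈E)
    d : Fin n → ℤ
    d = proj₁ lift
    d∈D : word (p ℕ.* p) d ∈C D
    d∈D = proj₁ (proj₂ lift)
    W : Fin n → ℤ
    W j = quotient (≡-mod-sym (proj₂ (proj₂ lift) j))
    X≡d+pW : ∀ j → X j ≡ d j + + p * W j
    X≡d+pW j = trans (quotient-spec (≡-mod-sym (proj₂ (proj₂ lift) j))) (cong (λ t → d j + t) (ℤ.*-comm (W j) (+ p)))
    pW∈E : word (p ℕ.* p) (λ j → + p * W j) ∈C E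
    pW∈E = ∈C-cong-mod E-code (λ j → ≡⇒≡-mod (trans (cong (_- d j) (X≡d+pW j)) (a+b-a≡b (d j) _)))
             (∈C-− E-code X∈E (D⊆E (word (p ℕ.* p) d) d∈D))
    pW∈D : word (p ℕ.* p) (λ j → + p * W j) ∈C D
    pW∈D = preimage-∈ D-pre (preimage-∈⁻¹ E-pre pW∈E)

  record SystematicLift {k r} (D : Code (p ℕ.* p) (k ℕ.+ r)) (R : Mat k (k ℕ.+ r)) : Set where
    field
      rows            : Mat k (k ℕ.+ r)
      rows-systematic : Systematic rows
      rows-∈          : ∀ i → word (p ℕ.* p) (rows i) ∈C D
      rows-≡-mod-p    : ∀ i j → rows i j ≡ R i j [mod + p ]

  -- Lift each row of R into D, then subtract p times the combination of rows of R that
  -- repairs the leading block.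
  systematic-lift : ∀ {k r} {C₁ E : Code p (k ℕ.+ r)} {D : Code (p ℕ.* p) (k ℕ.+ r)} {R : Mat k (k ℕ.+ r)} →
                    IsCode p C₁ → IsCode (p ℕ.* p) D → ImageIs p D C₁ → PreimageIs p D E → C₁ ⊆C E →
                    Systematic R → (∀ i → word p (R i) ∈C C₁) → SystematicLift D R
  systematic-lift {k} {r} {R = R} C₁-code D-code D-im D-pre C₁⊆E R-sys R∈C₁ = record
    { rows            = rows
    ; rows-systematic = systematic rows-leading
    ; rows-∈          = λ i → ∈C-− D-code (proj₁ (proj₂ (lift i)))
                          (preimage-∈ D-pre (C₁⊆E (word p (lincomb (Q i) R)) (∈C-lincomb C₁-code R∈C₁ (Q i))))
    ; rows-≡-mod-p    = λ i j → ≡-mod-trans (+-cong-mod (H≡R i j) (-‿cong-mod (M*≡0-mod (lincomb (Q i) R j))))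
                                  (≡⇒≡-mod (ℤ.+-identityʳ (R i j)))
    }
    where
    lift : ∀ i → ∃ λ h → word (p ℕ.* p) h ∈C _ × ∀ j → h j ≡ R i j [mod + p ]
    lift i = image-lift D-im (R∈C₁ i)
    H : Mat k (k ℕ.+ r)
    H i = proj₁ (lift i)
    H≡R : ∀ i j → H i j ≡ R i j [mod + p ]
    H≡R i = proj₂ (proj₂ (lift i))
    Q : Fin k → Fin k → ℤ
    Q i l = quotient (H≡R i (l ↑ˡ r))
    rows : Mat k (k ℕ.+ r)
    rows i j = H i j - + p * lincomb (Q i) R j
    rows-leading : ∀ i l → rows i (l ↑ˡ r) ≡ I k i l
    rows-leading i l = begin
      H i (l ↑ˡ r) - + p * lincomb (Q i) R (l ↑ˡ r)
        ≡⟨ cong₂ (λ a b → a - + p * b) (quotient-spec (H≡R i (l ↑ˡ r))) (lincomb-systematic R-sys (Q i) l) ⟩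
      R i (l ↑ˡ r) + Q i l * + p - + p * Q i l
        ≡⟨ a+bc-cb≡a (R i (l ↑ˡ r)) (Q i l) (+ p) ⟩
      R i (l ↑ˡ r)
        ≡⟨ leading-block R-sys i l ⟩
      I k i l
        ∎
      where
      open ≡-Reasoning
      a+bc-cb≡a : ∀ a b c → a + b * c - c * b ≡ a
      a+bc-cb≡a = solve-∀

module _ {p k r} .{{_ : NonZero p}} {C₁ : Code p (k ℕ.+ r)} {R G : Mat k (k ℕ.+ r)}
         (R-gen : HasGenerator p C₁ R) (G-sys : Systematic G) (G≡R : ∀ i j → G i j ≡ R i j [mod + p ]) where

  private
    G≡R-lincomb : ∀ a j → lincomb a G j ≡ lincomb a R j [mod + p ]
    G≡R-lincomb a = lincomb-cong-mod (λ _ → ≡-mod-refl) G≡R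

  span-residue : ImageIs p (span (p ℕ.* p) G) C₁
  span-residue v = mk⇔ to from
    where
    to : v ∈C C₁ → ∃ λ c → c ∈C span (p ℕ.* p) G × π p c ≡ v
    to v∈ with generator-coefficients R-gen {v} v∈
    ... | a , refl = word (p ℕ.* p) (lincomb a G) , word-lincomb-∈-span G-sys a ,
                     trans (π-word (lincomb a G)) (word-cong-mod (G≡R-lincomb a))
    from : (∃ λ c → c ∈C span (p ℕ.* p) G × π p c ≡ v) → v ∈C C₁
    from (c , c∈ , refl) with Equivalence.to (∈-span⇔ G-sys c) c∈
    ... | a , refl = subst (_∈C C₁) (sym (trans (π-word (lincomb a G)) (word-cong-mod (G≡R-lincomb a))))
                       (generator-∈ R-gen a)

  span-torsion : PreimageIs p (span (p ℕ.* p) G) C₁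
  span-torsion v = mk⇔ to from
    where
    to : v ∈C C₁ → ι p v ∈C span (p ℕ.* p) G
    to v∈ with generator-coefficients R-gen {v} v∈
    ... | a , refl = subst (_∈C span (p ℕ.* p) G) (sym (trans (ι-word (lincomb a R)) (word-cong-mod λ j →
                       ≡-mod-sym (≡-mod-trans (≡⇒≡-mod (lincomb-* (+ p) a G j)) (p*-cong-mod (G≡R-lincomb a j))))))
                       (word-lincomb-∈-span G-sys (λ i → + p * a i))
    from : ι p v ∈C span (p ℕ.* p) G → v ∈C C₁
    from ιv∈ with Equivalence.to (∈-span⇔ G-sys (ι p v)) ιv∈
    ... | a , ιv≡aG =
      subst (_∈C C₁) (trans (word-cong-mod (λ j → ≡-mod-sym (V≡bR j))) (word-repr v)) (generator-∈ R-gen b)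
      where
      V : Fin (k ℕ.+ r) → ℤ
      V = repr v
      pV≡aG : ∀ j → + p * V j ≡ lincomb a G j [mod + (p ℕ.* p) ]
      pV≡aG = word-injective-mod (trans (sym (ι-word V)) (trans (cong (ι p) (word-repr v)) ιv≡aG))
      b : Fin k → ℤ
      b l = V (l ↑ˡ r)
      a≡pb : ∀ l → a l ≡ + p * b l [mod + (p ℕ.* p) ]
      a≡pb l = ≡-mod-sym (≡-mod-trans (pV≡aG (l ↑ˡ r)) (≡⇒≡-mod (lincomb-systematic G-sys a l)))
      V≡bR : ∀ j → V j ≡ lincomb b R j [mod + p ]
      V≡bR j = p*-cancel-mod (≡-mod-trans (pV≡aG j) (≡-mod-trans (lincomb-cong-mod a≡pb (λ _ _ → ≡-mod-refl) j)
                 (≡-mod-trans (≡⇒≡-mod (lincomb-* (+ p) b G j)) (p*-cong-mod (G≡R-lincomb b j)))))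

-- The codes of X contained in C′

module Construction
  {p : ℕ} .{{_ : NonZero p}} {k₁ k₂ r : ℕ} (A : Mat k₁ r) (B : Mat k₂ r) {C₁ C₂ : Code p (k₁ ℕ.+ r)}
  (C₁-code : IsCode p C₁) (C₂-code : IsCode p C₂)
  (C₁-gen : HasGenerator p C₁ (hcat (I k₁) A))
  (C₂-gen : HasGenerator p C₂ (vcat (hcat (I k₁) A) (hcat (O k₂ k₁) B)))
  (C₂-dim : HasDim p C₂ (k₁ ℕ.+ k₂)) (C₁⊆C₂ : C₁ ⊆C C₂)
  {C′ : Code (p ℕ.* p) (k₁ ℕ.+ r)} (C′∈X′ : InX′ p C₁ C₂ C′)
  where

  private
    n = k₁ ℕ.+ r
    P² = p ℕ.* p

    R : Mat k₁ n
    R = hcat (I k₁) A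

    S : Mat k₂ n
    S = hcat (O k₂ k₁) B

    R-sys : Systematic R
    R-sys = hcat-I-systematic A

    R∈C₁ : ∀ i → word p (R i) ∈C C₁
    R∈C₁ i = subst (_∈C C₁) (word-cong-mod (λ j → ≡⇒≡-mod (lincomb-I R i j))) (generator-∈ C₁-gen (I k₁ i))

    S∈C₂ : ∀ l → word p (S l) ∈C C₂
    S∈C₂ l = subst (_∈C C₂) (word-cong-mod λ j → ≡⇒≡-mod (trans (lincomb-I (vcat R S) (k₁ ↑ʳ l) j) (vcat-↑ʳ R S l j)))
                (generator-∈ C₂-gen (I (k₁ ℕ.+ k₂) (k₁ ↑ʳ l)))

    C′-code  = proj₁ C′∈X′
    C′-so    = proj₁ (proj₂ C′∈X′)
    C′-im    = proj₁ (proj₂ (proj₂ C′∈X′))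
    C′-pre   = proj₂ (proj₂ (proj₂ C′∈X′))

    base : SystematicLift C′ R
    base = systematic-lift C₁-code C′-code C′-im C′-pre C₁⊆C₂ R-sys R∈C₁

    open SystematicLift base renaming (rows to G₀; rows-systematic to G₀-sys; rows-∈ to G₀∈C′; rows-≡-mod-p to G₀≡R)

  Offsets : Set
  Offsets = Fin k₁ → Fin k₂ → Fin p

  generator : Offsets → Mat k₁ n
  generator D i j = G₀ i j + + p * lincomb (λ l → ⟦ D i l ⟧) S j

  code : Offsets → Code P² n
  code D = span P² (generator D)

  generator-systematic : ∀ D → Systematic (generator D)
  generator-systematic D = systematic λ i l →
    trans (cong₂ (λ a b → a + + p * b) (leading-block G₀-sys i l) (lincomb-hcat-O _ B l))
          (trans (cong (λ t → I k₁ i l + t) (ℤ.*-zeroʳ (+ p))) (ℤ.+-identityʳ _))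

  generator≡R : ∀ D i j → generator D i j ≡ R i j [mod + p ]
  generator≡R D i j = ≡-mod-trans (+-cong-mod (G₀≡R i j) (M*≡0-mod (lincomb (λ l → ⟦ D i l ⟧) S j)))
                                  (≡⇒≡-mod (ℤ.+-identityʳ (R i j)))

  generator∈C′ : ∀ D i → word P² (generator D i) ∈C C′
  generator∈C′ D i = ∈C-+ C′-code (G₀∈C′ i) (preimage-∈ C′-pre (∈C-lincomb C₂-code S∈C₂ (λ l → ⟦ D i l ⟧)))

  code⊆C′ : ∀ D → code D ⊆C C′
  code⊆C′ D = span-⊆C (generator-systematic D) C′-code (generator∈C′ D)

  code∈X : ∀ D → InX p C₁ (code D)
  code∈X D = span-IsCode (generator-systematic D)
           , (λ x x∈ y y∈ → C′-so x (code⊆C′ D x x∈) y (code⊆C′ D y y∈))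
           , span-residue C₁-gen (generator-systematic D) (generator≡R D)
           , span-torsion C₁-gen (generator-systematic D) (generator≡R D)

  code-injective : ∀ D D′ → code D ≡ code D′ → ∀ i l → D i l ≡ D′ i l
  code-injective D D′ D≡D′ i l = ≡-mod⇒Fin-≡ (-≡0⇒≡-mod (begin
    ⟦ D i l ⟧ - ⟦ D′ i l ⟧ ≡⟨ VF.lookup-++ʳ {m = k₁} (λ _ → + 0) d l ⟨
    c (k₁ ↑ʳ l)            ≈⟨ generator-rows-independent C₂-code C₂-gen C₂-dim c cG₂≡0 (k₁ ↑ʳ l) ⟩
    + 0                    ∎))
    where
    open ≡-mod-Reasoning (+ p)
    d : Fin k₂ → ℤ
    d l = ⟦ D i l ⟧ - ⟦ D′ i l ⟧
    c : Fin (k₁ ℕ.+ k₂) → ℤ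
    c = (λ _ → + 0) VF.++ d
    pDS≡pD′S : ∀ j → + p * lincomb (λ l → ⟦ D i l ⟧) S j ≡ + p * lincomb (λ l → ⟦ D′ i l ⟧) S j [mod + P² ]
    pDS≡pD′S j = +-cancelˡ-mod (G₀ i j) (span-injective-mod (generator-systematic D) (generator-systematic D′) D≡D′ i j)
    cG₂≡0 : ∀ j → lincomb c (vcat R S) j ≡ + 0 [mod + p ]
    cG₂≡0 j = begin
      lincomb c (vcat R S) j ≈⟨ lincomb-vcat-bottom c R S (λ i → ≡⇒≡-mod (VF.lookup-++ˡ {n = k₂} (λ _ → + 0) d i)) j ⟩
      lincomb (λ l → c (k₁ ↑ʳ l)) S j ≈⟨ lincomb-cong-mod (λ l → ≡⇒≡-mod (VF.lookup-++ʳ {m = k₁} (λ _ → + 0) d l))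
                                                          (λ _ _ → ≡-mod-refl) j ⟩
      lincomb d S j          ≡⟨ lincomb-− _ _ S j ⟩
      _                      ≈⟨ ≡-mod⇒-≡0 (p*-cancel-mod (pDS≡pD′S j)) ⟩
      + 0                    ∎

  private
    module Completeness {C} (C∈X : InX p C₁ C) (C⊆C′ : C ⊆C C′) where

      C-code = proj₁ C∈X
      C-im   = proj₁ (proj₂ (proj₂ C∈X))
      C-pre  = proj₂ (proj₂ (proj₂ C∈X))

      open SystematicLift (systematic-lift C₁-code C-code C-im C-pre (λ _ v∈ → v∈) R-sys R∈C₁)
        renaming (rows to K; rows-systematic to K-sys; rows-∈ to K∈C; rows-≡-mod-p to K≡R)

      K≡G₀ : ∀ i j → K i j ≡ G₀ i j [mod + p ]
      K≡G₀ i j = ≡-mod-trans (K≡R i j) (≡-mod-sym (G₀≡R i j))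

      Y : Mat k₁ n
      Y i j = quotient (K≡G₀ i j)

      K≡G₀+pY : ∀ i j → K i j ≡ G₀ i j + + p * Y i j
      K≡G₀+pY i j = trans (quotient-spec (K≡G₀ i j)) (cong (λ t → G₀ i j + t) (ℤ.*-comm (Y i j) (+ p)))

      Y∈C₂ : ∀ i → word p (Y i) ∈C C₂
      Y∈C₂ i = preimage-∈⁻¹ C′-pre {v = Y i} (∈C-cong-mod C′-code {v = λ j → K i j - G₀ i j} {w = λ j → + p * Y i j}
        (λ j → ≡⇒≡-mod (trans (cong (_- G₀ i j) (K≡G₀+pY i j)) (a+b-a≡b (G₀ i j) (+ p * Y i j))))
        (∈C-− C′-code {v = K i} {w = G₀ i} (C⊆C′ (word P² (K i)) (K∈C i)) (G₀∈C′ i)))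
        where
        a+b-a≡b : ∀ a b → a + b - a ≡ b
        a+b-a≡b = solve-∀

      Y-leading : ∀ i l → Y i (l ↑ˡ r) ≡ + 0 [mod + p ]
      Y-leading i l = p*-cancel-mod (+-cancelˡ-mod (I k₁ i l) (≡⇒≡-mod (begin
        I k₁ i l + + p * Y i (l ↑ˡ r)      ≡⟨ cong (λ t → t + + p * Y i (l ↑ˡ r)) (leading-block G₀-sys i l) ⟨
        G₀ i (l ↑ˡ r) + + p * Y i (l ↑ˡ r) ≡⟨ K≡G₀+pY i (l ↑ˡ r) ⟨
        K i (l ↑ˡ r)                        ≡⟨ leading-block K-sys i l ⟩
        I k₁ i l                            ≡⟨ ℤ.+-identityʳ _ ⟨
        I k₁ i l + + 0                      ≡⟨ cong (λ t → I k₁ i l + t) (ℤ.*-zeroʳ (+ p)) ⟨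
        I k₁ i l + + p * + 0                ∎)))
        where open ≡-Reasoning

      α : Fin k₁ → Fin (k₁ ℕ.+ k₂) → ℤ
      α i = proj₁ (generator-coefficients C₂-gen {word p (Y i)} (Y∈C₂ i))

      Y≡αG₂ : ∀ i j → Y i j ≡ lincomb (α i) (vcat R S) j [mod + p ]
      Y≡αG₂ i = word-injective-mod (proj₂ (generator-coefficients C₂-gen {word p (Y i)} (Y∈C₂ i)))

      α-leading : ∀ i l → α i (l ↑ˡ k₂) ≡ + 0 [mod + p ]
      α-leading i l = ≡-mod-trans (≡⇒≡-mod (sym (lincomb-vcat-leading R-sys B (α i) l)))
                        (≡-mod-trans (≡-mod-sym (Y≡αG₂ i (l ↑ˡ r))) (Y-leading i l))

      D : Offsets
      D i l = [ p ] α i (k₁ ↑ʳ l)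

      DS≡Y : ∀ i j → lincomb (λ l → ⟦ D i l ⟧) S j ≡ Y i j [mod + p ]
      DS≡Y i j = begin
        lincomb (λ l → ⟦ D i l ⟧) S j     ≈⟨ lincomb-cong-mod (λ l → ⟦[]⟧≡-mod _) (λ _ _ → ≡-mod-refl) j ⟩
        lincomb (λ l → α i (k₁ ↑ʳ l)) S j ≈⟨ lincomb-vcat-bottom (α i) R S (α-leading i) j ⟨
        lincomb (α i) (vcat R S) j       ≈⟨ Y≡αG₂ i j ⟨
        Y i j                             ∎
        where open ≡-mod-Reasoning (+ p)

      generator≡K : ∀ i j → generator D i j ≡ K i j [mod + P² ]
      generator≡K i j = ≡-mod-trans (+-cong-mod (≡-mod-refl {x = G₀ i j}) (p*-cong-mod (DS≡Y i j)))
                                    (≡⇒≡-mod (sym (K≡G₀+pY i j)))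

      code⊆C : code D ⊆C C
      code⊆C = span-⊆C (generator-systematic D) C-code
                 (λ i → ∈C-cong-mod C-code (λ j → ≡-mod-sym (generator≡K i j)) (K∈C i))

      C⊆code : C ⊆C code D
      C⊆code = ⊆-same-residue-torsion⇒⊇ (span-IsCode (generator-systematic D)) C-code code⊆C
                 (span-residue C₁-gen (generator-systematic D) (generator≡R D)) C-im
                 (span-torsion C₁-gen (generator-systematic D) (generator≡R D)) C-pre

  code-complete : ∀ {C} → InX p C₁ C → C ⊆C C′ → ∃ λ D → C ≡ code D
  code-complete C∈X C⊆C′ = D , ⊆C-antisym C⊆code code⊆C
    where open Completeness C∈X C⊆C′

  code-cong : ∀ {D D′} → (∀ i l → D i l ≡ D′ i l) → code D ≡ code D′
  code-cong {D} {D′} D≗D′ = span-cong-mod (generator-systematic D) (generator-systematic D′)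
    (λ i j → +-cong-mod (≡-mod-refl {x = G₀ i j}) (*-cong-mod (≡-mod-refl {x = + p})
      (lincomb-cong-mod (λ l → ≡⇒≡-mod (cong ⟦_⟧ (D≗D′ i l))) (λ _ _ → ≡-mod-refl) j)))

  enumeration : Σ (List (Code P² n)) λ L →
                  Unique L × length L ≡ p ^ (k₁ ℕ.* k₂) × (∀ C → (C ∈ L) ⇔ (InX p C₁ C × C ⊆C C′))
  enumeration =
    codes , Unique.tabulate⁺ codeAt-injective , List.length-tabulate codeAt , λ C → mk⇔ (sound C) (complete C)
    where
    codeAt : Fin (p ^ (k₁ ℕ.* k₂)) → Code P² n
    codeAt t = code (matrixOf t)

    codes : List (Code P² n)
    codes = List.tabulate codeAt

    codeAt-injective : ∀ {t t′} → codeAt t ≡ codeAt t′ → t ≡ t′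
    codeAt-injective {t} {t′} eq = matrixOf-injective (code-injective (matrixOf t) (matrixOf t′) eq)

    sound : ∀ C → C ∈ codes → InX p C₁ C × C ⊆C C′
    sound C C∈ = subst (λ C → InX p C₁ C × C ⊆C C′) (sym (proj₂ hit)) (code∈X (matrixOf t) , code⊆C′ (matrixOf t))
      where
      hit : ∃ λ t → C ≡ codeAt t
      hit = ∈-tabulate⁻ C∈
      t : Fin (p ^ (k₁ ℕ.* k₂))
      t = proj₁ hit

    complete : ∀ C → InX p C₁ C × C ⊆C C′ → C ∈ codes
    complete C (C∈X , C⊆C′) =
      subst (_∈ codes) (trans (code-cong (proj₂ index)) (sym (proj₂ offsets))) (∈-tabulate⁺ {f = codeAt} (proj₁ index))
      where
      offsets : ∃ λ D → C ≡ code D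
      offsets = code-complete C∈X C⊆C′
      index : ∃ λ t → ∀ i l → matrixOf t i l ≡ proj₁ offsets i l
      index = matrixOf-surjective (proj₁ offsets)

lemma4p4 : (p : ℕ) .{{_ : NonZero p}} → Prime p →
    (k₁ k₂ r : ℕ) (A : Mat k₁ r) (B : Mat k₂ r) (C₁ C₂ : Code p (k₁ ℕ.+ r)) →
    IsCode p C₁ → IsCode p C₂ →
    HasGenerator p C₁ (hcat (I k₁) A) →
    HasGenerator p C₂ (vcat (hcat (I k₁) A) (hcat (O k₂ k₁) B)) →
    HasDim p C₁ k₁ → HasDim p C₂ (k₁ ℕ.+ k₂) →
    C₁ ⊆C C₂ → C₂ ⊆⊥ C₁ →
    (p ≡ 2 → DoublyEven C₁) →
    (C′ : Code (p ℕ.* p) (k₁ ℕ.+ r)) → InX′ p C₁ C₂ C′ →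
    Σ (List (Code (p ℕ.* p) (k₁ ℕ.+ r))) λ L →
      Unique L × length L ≡ p ^ (k₁ ℕ.* k₂) ×
      (∀ C → (C ∈ L) ⇔ (InX p C₁ C × C ⊆C C′))
lemma4p4 p _ k₁ k₂ r A B C₁ C₂ C₁-code C₂-code C₁-gen C₂-gen _ C₂-dim C₁⊆C₂ _ _ C′ C′∈X′ =
  Construction.enumeration A B C₁-code C₂-code C₁-gen C₂-gen C₂-dim C₁⊆C₂ C′∈X′
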